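{- Let $n,m$ be integers with $4\le m\le n/2$ and let $G=C(n;1,m)$. Then $b(G) < \sqrt{\frac nm}+\frac m2+1$.
   Context: For an integer $n$ and positive integers $s_1<\dots<s_t\le n/2$, the circulant graph $C(n;s_1,\dots,s_t)$ has vertex set $\mathbb Z_n$, with distinct vertices $x,y$ adjacent iff $x-y \equiv \pm s_i \pmod n$ for some $i$. For a finite connected graph $G$, let $N_\ell[x]=\{y: d(x,y)\le \ell\}$. A sequence of vertices $(x_1,\dots,x_k)$ is a burning sequence of $G$ if $N_{k-1}[x_1]\cup N_{k-2}[x_2]\cup\cdots\cup N_0[x_k]=V(G)$; the burning number $b(G)$ is the minimum length of a burning sequence of $G$. -}

module Defs where

open import Data.Nat using (ℕ; zero; suc; _+_; _*_; _∸_; _^_; _≤_; _<_; NonZero)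
open import Data.Nat.DivMod using (_%_)
open import Data.Fin using (Fin; toℕ)
open import Data.Product using (Σ; ∃; _×_)
open import Data.Sum using (_⊎_)
open import Relation.Binary.PropositionalEquality using (_≡_; _≢_)

Graph : ℕ → Set₁
Graph n = Fin n → Fin n → Set

-- Distinct x, y are adjacent iff x - y ≡ ±a or ±b (mod n).
-- "x - y ≡ ± s (mod n)" is written as  y ≡ x + s (mod n)  or  x ≡ y + s (mod n).
JumpAdj : (n : ℕ) → .{{_ : NonZero n}} → ℕ → Fin n → Fin n → Set
JumpAdj n s x y = (toℕ y ≡ (toℕ x + s) % n) ⊎ (toℕ x ≡ (toℕ y + s) % n)

Circulant2 : (n : ℕ) → .{{_ : NonZero n}} → ℕ → ℕ → Graph n
Circulant2 n a b x y = (x ≢ y) × (JumpAdj n a x y ⊎ JumpAdj n b x y)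

-- Within G ℓ x y  :⇔  d_G(x, y) ≤ ℓ, i.e. y ∈ N_ℓ[x]
-- (there is a walk from x to y of length at most ℓ).
data Within {n : ℕ} (G : Graph n) : ℕ → Fin n → Fin n → Set where
  here : ∀ {ℓ x} → Within G ℓ x x
  step : ∀ {ℓ x z y} → G x z → Within G ℓ z y → Within G (suc ℓ) x y

-- (x₁,…,x_k), given as xs : Fin k → Fin n with xs i = x_{i+1}, is a burning
-- sequence iff N_{k-1}[x₁] ∪ … ∪ N_0[x_k] = V(G).
IsBurningSeq : {n : ℕ} → Graph n → (k : ℕ) → (Fin k → Fin n) → Set
IsBurningSeq G k xs = ∀ y → ∃ λ (i : Fin k) → Within G (k ∸ suc (toℕ i)) (xs i) y

IsBurningNumber : {n : ℕ} → Graph n → ℕ → Set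
IsBurningNumber {n} G b =
  (Σ (Fin b → Fin n) (IsBurningSeq G b)) ×
  (∀ k (xs : Fin k → Fin n) → IsBurningSeq G k xs → b ≤ k)

-- For naturals b, n and m ≥ 1:   b < √(n/m) + m/2 + 1
-- ⇔ 2b - m - 2 < 2√(n/m)
-- ⇔ 2b < m + 2,  or  (m + 2 ≤ 2b  and  m (2b - m - 2)² < 4n).
BelowBound : (b n m : ℕ) → Set
BelowBound b n m =
  (2 * b < m + 2) ⊎ ((m + 2 ≤ 2 * b) × (m * (2 * b ∸ (m + 2)) ^ 2 < 4 * n))

-- Write m = 2ρ + 1 + e with e ≤ 1.  In C(n; 1, m) every t ≤ u m + ρ is reached from 0
-- within u + ρ steps: jumps of m, unit steps forward, and at most ρ unit steps back.
-- Cut 0, …, n - 1 into consecutive segments of lengths 2 (u m + ρ) + 1, u = 0, 1, …;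
-- segment u is burnt by a fire lit at its centre with radius u + ρ.  If V + 1 segments
-- are needed, b ≤ V + ρ + 1, and minimality of V gives m V² - e V < n, which is the bound.
module Submission where

open import Defs
open import Data.Nat using (ℕ; zero; suc; _+_; _*_; _∸_; _^_; _≤_; _<_; NonZero; z≤n; s≤s; _≤?_; _<?_)
open import Data.Nat.Properties
open import Data.Nat.DivMod using (_%_; _/_; m%n<n; m<n⇒m%n≡m; m≡m%n+[m/n]*n; %-distribˡ-+; m%n%n≡m%n)
open import Data.Nat.Tactic.RingSolver using (solve-∀)
open import Data.Fin using (Fin; toℕ; fromℕ<)
open import Data.Fin.Properties using (toℕ-fromℕ<; toℕ<n; toℕ-injective)
open import Data.Product using (∃; ∃₂; _×_; _,_)
open import Data.Sum using (_⊎_; inj₁; inj₂; swap)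
import Data.Sum as Sum
open import Function using (_∘_)
open import Relation.Binary.Definitions using (Symmetric)
open import Relation.Binary.PropositionalEquality
open import Relation.Nullary using (¬_; yes; no; contradiction)
open import Relation.Unary using (Decidable)

module _ {n : ℕ} {G : Graph n} where

  Within-mono : ∀ {ℓ ℓ′ x y} → ℓ ≤ ℓ′ → Within G ℓ x y → Within G ℓ′ x y
  Within-mono _          here       = here
  Within-mono (s≤s ℓ≤ℓ′) (step g w) = step g (Within-mono ℓ≤ℓ′ w)

  Within-++ : ∀ {ℓ₁ ℓ₂ x z y} → Within G ℓ₁ x z → Within G ℓ₂ z y → Within G (ℓ₁ + ℓ₂) x y
  Within-++ {ℓ₁} {ℓ₂} here w = Within-mono (m≤n+m ℓ₂ ℓ₁) w
  Within-++ (step g w) w′    = step g (Within-++ w w′)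

  Within-reverse : Symmetric G → ∀ {ℓ x y} → Within G ℓ x y → Within G ℓ y x
  Within-reverse G-sym here = here
  Within-reverse G-sym {suc ℓ} (step g w) =
    Within-mono (≤-reflexive (+-comm ℓ 1)) (Within-++ (Within-reverse G-sym w) (step (G-sym g) here))

burningSeq-byRadius : ∀ {n} (G : Graph n) k (c : ℕ → Fin n) →
  (∀ y → ∃ λ r → r < k × Within G r (c r) y) →
  IsBurningSeq G k (λ i → c (k ∸ suc (toℕ i)))
burningSeq-byRadius G zero    c covered y with covered y
... | _ , () , _
burningSeq-byRadius G (suc k) c covered y with covered y
... | r , s≤s r≤k , w = i , subst (λ r′ → Within G r′ (c r′) y) (sym radius) w
  where
  i : Fin (suc k)
  i = fromℕ< (s≤s (m∸n≤m k r))
  radius : k ∸ toℕ i ≡ r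
  radius = trans (cong (k ∸_) (toℕ-fromℕ< (s≤s (m∸n≤m k r)))) (m∸[m∸n]≡n r≤k)

Circulant2-sym : ∀ {n} .{{_ : NonZero n}} {a b} → Symmetric (Circulant2 n a b)
Circulant2-sym (x≢y , adj) = x≢y ∘ sym , Sum.map swap swap adj

[m%n+k]%n≡[m+k]%n : ∀ m k n .{{_ : NonZero n}} → (m % n + k) % n ≡ (m + k) % n
[m%n+k]%n≡[m+k]%n m k n = begin
  (m % n + k) % n          ≡⟨ %-distribˡ-+ (m % n) k n ⟩
  (m % n % n + k % n) % n  ≡⟨ cong (λ v → (v + k % n) % n) (m%n%n≡m%n m n) ⟩
  (m % n + k % n) % n      ≡⟨ %-distribˡ-+ m k n ⟨
  (m + k) % n              ∎
  where open ≡-Reasoning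

-- r + s ≡ (r + s) % n + q * n would force s ≡ q * n.
m≢[m+s]%n : ∀ r {s n} .{{_ : NonZero n}} → 0 < s → s < n → r ≢ (r + s) % n
m≢[m+s]%n r {s} {n} 0<s s<n eq = not-multiple ((r + s) / n) s≡qn
  where
  s≡qn : s ≡ (r + s) / n * n
  s≡qn = +-cancelˡ-≡ r s _ (trans (m≡m%n+[m/n]*n (r + s) n) (cong (_+ (r + s) / n * n) (sym eq)))
  not-multiple : ∀ q → s ≢ q * n
  not-multiple zero    e = <-irrefl (sym e) 0<s
  not-multiple (suc q) e = <-irrefl e (<-≤-trans s<n (m≤m+n n (q * n)))

-- A route to t: go forward by jumps * m + ones, then come back by back.
record Route (m R t : ℕ) : Set where
  constructor route
  field
    jumps ones back : ℕ
    cost  : jumps + ones + back ≤ R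
    lands : t + back ≡ jumps * m + ones

Route-ones : ∀ {m R t} → t ≤ R → Route m R t
Route-ones {t = t} t≤R = route 0 t 0 (≤-trans (≤-reflexive (+-identityʳ t)) t≤R) (+-identityʳ t)

Route-weaken : ∀ {m R R′ t} → R ≤ R′ → Route m R t → Route m R′ t
Route-weaken R≤R′ (route a b d cost lands) = route a b d (≤-trans cost R≤R′) lands

Route-jump : ∀ {m R t} → Route m R t → Route m (suc R) (m + t)
Route-jump {m} {t = t} (route a b d cost lands) = route (suc a) b d (s≤s cost) (begin
  m + t + d        ≡⟨ +-assoc m t d ⟩
  m + (t + d)      ≡⟨ cong (m +_) lands ⟩
  m + (a * m + b)  ≡⟨ +-assoc m (a * m) b ⟨
  m + a * m + b    ∎)
  where open ≡-Reasoning

-- Below m, either walk forward t ≤ ρ + 1 steps, or jump once and walk back m ∸ t ≤ ρ steps.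
Route-below : ∀ {m ρ t} → m ≤ 2 + (ρ + ρ) → t < m → Route m (suc ρ) t
Route-below {m} {ρ} {t} m≤2+2ρ t<m with t ≤? suc ρ
... | yes t≤1+ρ = Route-ones t≤1+ρ
... | no  t≰1+ρ with d , t+d≡m ← m≤n⇒∃[o]m+o≡n (<⇒≤ t<m) =
  route 1 0 d (s≤s d≤ρ) (trans t+d≡m (sym (trans (+-identityʳ (1 * m)) (*-identityˡ m))))
  where
  d≤ρ : d ≤ ρ
  d≤ρ = +-cancelˡ-≤ (2 + ρ) d ρ (≤-trans (+-monoˡ-≤ d (≰⇒> t≰1+ρ)) (≤-trans (≤-reflexive t+d≡m) m≤2+2ρ))

route-within : ∀ {m ρ} → m ≤ 2 + (ρ + ρ) → ∀ u t → t ≤ u * m + ρ → Route m (u + ρ) t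
route-within m≤2+2ρ zero    t t≤ρ = Route-ones t≤ρ
route-within {m} {ρ} m≤2+2ρ (suc u) t t≤ with m ≤? t
... | yes m≤t with t′ , refl ← m≤n⇒∃[o]m+o≡n m≤t =
  Route-jump (route-within m≤2+2ρ u t′ (+-cancelˡ-≤ m t′ _ (≤-trans t≤ (≤-reflexive (+-assoc m (u * m) ρ)))))
... | no m≰t = Route-weaken (s≤s (m≤n+m ρ u)) (Route-below m≤2+2ρ (≰⇒> m≰t))

module Segments (m ρ : ℕ) where

  halfWidth : ℕ → ℕ
  halfWidth u = u * m + ρ

  start : ℕ → ℕ
  start zero    = 0
  start (suc u) = start u + suc (halfWidth u + halfWidth u)

  centre : ℕ → ℕ
  centre u = start u + halfWidth u

  n≤start : ∀ n → n ≤ start n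
  n≤start zero    = z≤n
  n≤start (suc n) = ≤-trans (≤-reflexive (+-comm 1 n)) (+-mono-≤ (n≤start n) (s≤s z≤n))

  segment-cover : ∀ U y → y < start U →
    ∃ λ u → u < U × start u ≤ y × y ≤ start u + (halfWidth u + halfWidth u)
  segment-cover (suc U) y y< with y <? start U
  ... | yes y<start with u , u<U , lo , hi ← segment-cover U y y<start = u , m<n⇒m<1+n u<U , lo , hi
  ... | no  y≮start = U , ≤-refl , ≮⇒≥ y≮start , ≤-pred (≤-trans y< (≤-reflexive (+-suc (start U) _)))

least-suc : ∀ {P : ℕ → Set} → Decidable P → ∀ U → P (suc U) → ∃ λ V → P (suc V) × (V ≡ 0 ⊎ ¬ P V)
least-suc P? zero    p = 0 , p , inj₁ refl
least-suc P? (suc U) p with P? (suc U)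
... | yes p′ = least-suc P? U p′
... | no ¬p′ = suc U , p , inj₂ ¬p′

module CirculantWalks (n m ρ : ℕ) .{{_ : NonZero n}} (0<m : 0 < m) (m<n : m < n)
                      (m≤2+2ρ : m ≤ 2 + (ρ + ρ)) where
  open Segments m ρ

  1<n : 1 < n
  1<n = ≤-trans (s≤s 0<m) m<n

  G : Graph n
  G = Circulant2 n 1 m

  vertex : ℕ → Fin n
  vertex x = fromℕ< (m%n<n x n)

  toℕ-vertex : ∀ x → toℕ (vertex x) ≡ x % n
  toℕ-vertex x = toℕ-fromℕ< (m%n<n x n)

  vertex-toℕ : ∀ y → vertex (toℕ y) ≡ y
  vertex-toℕ y = toℕ-injective (trans (toℕ-vertex (toℕ y)) (m<n⇒m%n≡m (toℕ<n y)))

  jump : ∀ {s} → 0 < s → s < n → ∀ x → (vertex x ≢ vertex (x + s)) × JumpAdj n s (vertex x) (vertex (x + s))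
  jump {s} 0<s s<n x = distinct , inj₁ adjacent
    where
    adjacent : toℕ (vertex (x + s)) ≡ (toℕ (vertex x) + s) % n
    adjacent = begin
      toℕ (vertex (x + s))      ≡⟨ toℕ-vertex (x + s) ⟩
      (x + s) % n               ≡⟨ [m%n+k]%n≡[m+k]%n x s n ⟨
      (x % n + s) % n           ≡⟨ cong (λ v → (v + s) % n) (toℕ-vertex x) ⟨
      (toℕ (vertex x) + s) % n  ∎
      where open ≡-Reasoning
    distinct : vertex x ≢ vertex (x + s)
    distinct eq = m≢[m+s]%n (toℕ (vertex x)) 0<s s<n (trans (cong toℕ eq) adjacent)

  edge-1 : ∀ x → G (vertex x) (vertex (x + 1))
  edge-1 x with x≢ , adj ← jump (s≤s z≤n) 1<n x = x≢ , inj₁ adj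

  edge-m : ∀ x → G (vertex x) (vertex (x + m))
  edge-m x with x≢ , adj ← jump 0<m m<n x = x≢ , inj₂ adj

  walk-ones : ∀ b x → Within G b (vertex x) (vertex (x + b))
  walk-ones zero    x rewrite +-identityʳ x = here
  walk-ones (suc b) x = subst (Within G (suc b) (vertex x) ∘ vertex) (+-assoc x 1 b)
    (step (edge-1 x) (walk-ones b (x + 1)))

  walk-jumps : ∀ a x → Within G a (vertex x) (vertex (x + a * m))
  walk-jumps zero    x rewrite +-identityʳ x = here
  walk-jumps (suc a) x = subst (Within G (suc a) (vertex x) ∘ vertex) (+-assoc x m (a * m))
    (step (edge-m x) (walk-jumps a (x + m)))

  Route-walk : ∀ {R t} → Route m R t → ∀ x → Within G R (vertex x) (vertex (x + t))
  Route-walk {t = t} (route a b d cost lands) x = Within-mono cost (Within-++ there back)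
    where
    there : Within G (a + b) (vertex x) (vertex (x + t + d))
    there = subst (Within G (a + b) (vertex x) ∘ vertex)
      (trans (+-assoc x (a * m) b) (trans (cong (x +_) (sym lands)) (sym (+-assoc x t d))))
      (Within-++ (walk-jumps a x) (walk-ones b (x + a * m)))
    back : Within G d (vertex (x + t + d)) (vertex (x + t))
    back = Within-reverse Circulant2-sym (walk-ones d (x + t))

  ball : ∀ u {c t} → t ≤ halfWidth u → Within G (u + ρ) (vertex c) (vertex (c + t))
  ball u t≤ = Route-walk (route-within m≤2+2ρ u _ t≤) _

  segment-within : ∀ u {y} → start u ≤ y → y ≤ start u + (halfWidth u + halfWidth u) →
    Within G (u + ρ) (vertex (centre u)) (vertex y)
  segment-within u {y} lo hi with ≤-total (centre u) y
  ... | inj₁ c≤y with t , refl ← m≤n⇒∃[o]m+o≡n c≤y =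
    ball u (+-cancelˡ-≤ (centre u) t _ (≤-trans hi (≤-reflexive (sym (+-assoc (start u) _ _)))))
  ... | inj₂ y≤c with t , y+t≡c ← m≤n⇒∃[o]m+o≡n y≤c =
    Within-reverse Circulant2-sym (subst (Within G (u + ρ) (vertex y) ∘ vertex) y+t≡c (ball u t≤w))
    where
    t≤w : t ≤ halfWidth u
    t≤w = +-cancelˡ-≤ y t _ (≤-trans (≤-reflexive y+t≡c) (+-monoˡ-≤ (halfWidth u) lo))

  burns : ∀ V → n ≤ start (suc V) →
    IsBurningSeq G (suc (V + ρ)) (λ i → vertex (centre (suc (V + ρ) ∸ suc (toℕ i) ∸ ρ)))
  burns V n≤ = burningSeq-byRadius G (suc (V + ρ)) (λ r → vertex (centre (r ∸ ρ))) covered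
    where
    covered : ∀ y → ∃ λ r → r < suc (V + ρ) × Within G r (vertex (centre (r ∸ ρ))) y
    covered y with u , u<1+V , lo , hi ← segment-cover (suc V) (toℕ y) (<-≤-trans (toℕ<n y) n≤) =
      u + ρ , s≤s (+-monoˡ-≤ ρ (≤-pred u<1+V)) ,
      subst₂ (λ c → Within G (u + ρ) (vertex (centre c))) (sym (m+n∸n≡m u ρ)) (vertex-toℕ y)
        (segment-within u lo hi)

  burningNumber≤ : ∀ b → IsBurningNumber G b → ∃ λ V → b ≤ suc (V + ρ) × (V ≡ 0 ⊎ ¬ n ≤ start V)
  burningNumber≤ b (_ , minimal)
    with V , n≤start , least ← least-suc (λ V → n ≤? start V) n (≤-trans (n≤1+n n) (n≤start (suc n))) =
    V , minimal _ _ (burns V n≤start) , least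

halve : ∀ m → 0 < m → ∃₂ λ ρ e → e ≤ 1 × m ≡ suc (ρ + ρ + e)
halve 1             _ = 0 , 0 , z≤n , refl
halve 2             _ = 0 , 1 , s≤s z≤n , refl
halve (suc (suc (suc m))) _ with ρ , e , e≤1 , refl ← halve (suc m) (s≤s z≤n) =
  suc ρ , e , e≤1 , cong (λ v → suc (suc (v + e))) (sym (+-suc ρ ρ))

-- Σ_{u<U} (2 (u m + ρ) + 1) = m U (U - 1) + (2ρ + 1) U  and  2ρ + 1 = m - e.
start-closed : ∀ ρ e U → Segments.start (suc (ρ + ρ + e)) ρ U + e * U ≡ suc (ρ + ρ + e) * (U * U)
start-closed ρ e zero    = trans (*-zeroʳ e) (sym (*-zeroʳ (suc (ρ + ρ + e))))
start-closed ρ e (suc U) = begin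
  S U + suc (w + w) + e * suc U      ≡⟨ regroup (S U) U ρ e ⟩
  S U + e * U + (suc (w + w) + e)    ≡⟨ cong (_+ (suc (w + w) + e)) (start-closed ρ e U) ⟩
  m * (U * U) + (suc (w + w) + e)    ≡⟨ square ρ e U ⟩
  m * (suc U * suc U)                ∎
  where
  open ≡-Reasoning
  m = suc (ρ + ρ + e)
  S = Segments.start m ρ
  w = U * m + ρ
  regroup : ∀ X U ρ e → X + suc ((U * suc (ρ + ρ + e) + ρ) + (U * suc (ρ + ρ + e) + ρ)) + e * suc U
    ≡ X + e * U + (suc ((U * suc (ρ + ρ + e) + ρ) + (U * suc (ρ + ρ + e) + ρ)) + e)
  regroup = solve-∀
  square : ∀ ρ e U → suc (ρ + ρ + e) * (U * U) + (suc ((U * suc (ρ + ρ + e) + ρ) + (U * suc (ρ + ρ + e) + ρ)) + e)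
    ≡ suc (ρ + ρ + e) * (suc U * suc U)
  square = solve-∀

BelowBound-antitone : ∀ {b k n m} → b ≤ k → BelowBound k n m → BelowBound b n m
BelowBound-antitone {b} {k} {n} {m} b≤k below with 2 * b <? m + 2
... | yes 2b<m+2 = inj₁ 2b<m+2
... | no  2b≮m+2 with below
...   | inj₁ 2k<m+2 = contradiction (≤-<-trans (*-monoʳ-≤ 2 b≤k) 2k<m+2) 2b≮m+2
...   | inj₂ (_ , gap) = inj₂ (≮⇒≥ 2b≮m+2 ,
          ≤-<-trans (*-monoʳ-≤ m (^-monoˡ-≤ 2 (∸-monoˡ-≤ (m + 2) (*-monoʳ-≤ 2 b≤k)))) gap)

BelowBound-intro : ∀ {b n m} D → 2 * b ≡ m + 2 + D → m * D ^ 2 < 4 * n → BelowBound b n m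
BelowBound-intro {b} {n} {m} D 2b≡ lt = inj₂ (≤-trans (m≤m+n (m + 2) D) (≤-reflexive (sym 2b≡)) ,
  subst (λ v → m * v ^ 2 < 4 * n) (sym (trans (cong (_∸ (m + 2)) 2b≡) (m+n∸m≡n (m + 2) D))) lt)

odd-gap≤4·start : ∀ ρ W → let m = suc (ρ + ρ + 0) in m * suc (W + W) ^ 2 ≤ 4 * Segments.start m ρ (suc W)
odd-gap≤4·start ρ W = ≤-trans (m≤m+n _ _) (≤-reflexive (begin
  m * suc (W + W) ^ 2 + m * (4 * W + 3)  ≡⟨ expand ρ W ⟩
  4 * (m * (suc W * suc W))              ≡⟨ cong (4 *_) (start-closed ρ 0 (suc W)) ⟨
  4 * (S + 0)                            ≡⟨ cong (4 *_) (+-identityʳ S) ⟩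
  4 * S                                  ∎))
  where
  open ≡-Reasoning
  m = suc (ρ + ρ + 0)
  S = Segments.start m ρ (suc W)
  expand : ∀ ρ W → suc (ρ + ρ + 0) * (suc (W + W) * (suc (W + W) * 1)) + suc (ρ + ρ + 0) * (4 * W + 3)
    ≡ 4 * (suc (ρ + ρ + 0) * (suc W * suc W))
  expand = solve-∀

even-gap≤4·start : ∀ ρ W → let m = suc (ρ + ρ + 1) in m * (W + W) ^ 2 ≤ 4 * Segments.start m ρ (suc W)
even-gap≤4·start ρ W = ≤-trans (m≤m+n _ _) (≤-reflexive (+-cancelʳ-≡ (4 * (1 * suc W)) _ _ (begin
  m * (W + W) ^ 2 + X + 4 * (1 * suc W)  ≡⟨ expand ρ W ⟩
  4 * (m * (suc W * suc W))              ≡⟨ cong (4 *_) (start-closed ρ 1 (suc W)) ⟨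
  4 * (S + 1 * suc W)                    ≡⟨ *-distribˡ-+ 4 S (1 * suc W) ⟩
  4 * S + 4 * (1 * suc W)                ∎)))
  where
  open ≡-Reasoning
  m = suc (ρ + ρ + 1)
  S = Segments.start m ρ (suc W)
  X = 4 * (4 * ρ * W + 2 * ρ + 3 * W + 1)
  expand : ∀ ρ W → suc (ρ + ρ + 1) * ((W + W) * ((W + W) * 1)) + 4 * (4 * ρ * W + 2 * ρ + 3 * W + 1) + 4 * (1 * suc W)
    ≡ 4 * (suc (ρ + ρ + 1) * (suc W * suc W))
  expand = solve-∀

-- For V = suc W, 2 (V + ρ + 1) ∸ (m + 2) is 2W + 1 ∸ e, and start V < n bounds its square.
belowBound-least : ∀ ρ e → e ≤ 1 → ∀ n V → V ≡ 0 ⊎ ¬ n ≤ Segments.start (suc (ρ + ρ + e)) ρ V →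
  BelowBound (suc (V + ρ)) n (suc (ρ + ρ + e))
belowBound-least ρ e _ n zero _ = inj₁ (≤-trans (m≤m+n _ e) (≤-reflexive (identity ρ e)))
  where
  identity : ∀ ρ e → suc (2 * suc ρ) + e ≡ suc (ρ + ρ + e) + 2
  identity = solve-∀
belowBound-least ρ .0 z≤n n (suc W) (inj₂ n≰) =
  BelowBound-intro {suc (suc W + ρ)} {n} (suc (W + W)) (identity ρ W)
    (≤-<-trans (odd-gap≤4·start ρ W) (*-monoʳ-< 4 (≰⇒> n≰)))
  where
  identity : ∀ ρ W → 2 * suc (suc W + ρ) ≡ suc (ρ + ρ + 0) + 2 + suc (W + W)
  identity = solve-∀
belowBound-least ρ .1 (s≤s z≤n) n (suc W) (inj₂ n≰) =
  BelowBound-intro {suc (suc W + ρ)} {n} (W + W) (identity ρ W)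
    (≤-<-trans (even-gap≤4·start ρ W) (*-monoʳ-< 4 (≰⇒> n≰)))
  where
  identity : ∀ ρ W → 2 * suc (suc W + ρ) ≡ suc (ρ + ρ + 1) + 2 + (W + W)
  identity = solve-∀

burningNumber-bound : ∀ n ρ e .{{_ : NonZero n}} → e ≤ 1 → suc (ρ + ρ + e) < n →
  ∀ b → IsBurningNumber (Circulant2 n 1 (suc (ρ + ρ + e))) b → BelowBound b n (suc (ρ + ρ + e))
burningNumber-bound n ρ e e≤1 m<n b burning =
  let V , b≤ , least = burningNumber≤ b burning
  in  BelowBound-antitone {n = n} b≤ (belowBound-least ρ e e≤1 n V least)
  where
  m≤2+2ρ : suc (ρ + ρ + e) ≤ 2 + (ρ + ρ)
  m≤2+2ρ = s≤s (≤-trans (+-monoʳ-≤ (ρ + ρ) e≤1) (≤-reflexive (+-comm (ρ + ρ) 1)))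
  open CirculantWalks n (suc (ρ + ρ + e)) ρ (s≤s z≤n) m<n m≤2+2ρ

mainTheorem8 : (n m : ℕ) → .{{_ : NonZero n}} → 4 ≤ m → 2 * m ≤ n →
    (b : ℕ) → IsBurningNumber (Circulant2 n 1 m) b → BelowBound b n m
mainTheorem8 n m 4≤m 2m≤n with ρ , e , e≤1 , refl ← halve m (≤-trans (s≤s z≤n) 4≤m) =
  burningNumber-bound n ρ e e≤1 (<-≤-trans (m<m+n m (s≤s z≤n)) 2m≤n)
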